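{- Let $\mathcal{C}$ be an adequate set of formulas. The rules of weakening $\Gamma\{\emptyset\}$ / $\Gamma\{\Delta\}$, merge $\Gamma\{[\Delta]_i,[\Sigma]_i\}$ / $\Gamma\{[\Delta,\Sigma]_i\}$, and monotonicity $\Gamma\{[\Delta]_i\}$ / $\Gamma\{[\Delta]_j\}$ (for $i\le j$) are admissible for $\mathsf{GLP_{NS}}+\mathsf{cut}(\mathcal{C})$, i.e. whenever the premise is provable in $\mathsf{GLP_{NS}}+\mathsf{cut}(\mathcal{C})$, so is the conclusion.
   Context: Formulas are built from atoms $p$, complements $\overline{p}$, $\top,\bot$, $\wedge,\vee$, and $\Box_i,\Diamond_i$ ($i\in\mathbb{N}$); negation $\overline{A}$ is defined via De Morgan laws, $\overline{\overline{p}}=p$, $\overline{\top}=\bot$, $\overline{\bot}=\top$, $\overline{\Box_iA}=\Diamond_i\overline{A}$, $\overline{\Diamond_iA}=\Box_i\overline{A}$. A finite set of formulas is adequate if it is closed under subformulas and under negation. A nested sequent is (inductively) a finite multiset of formulas and of expressions $[\Delta]_i$ with $\Delta$ a nested sequent and $i\in\mathbb{N}$. A unary context $\Gamma\{\ \}$ is a nested sequent with one hole in place of a formula; $\Gamma\{\Upsilon\}$ fills the hole with $\Upsilon$, $\Gamma\{\emptyset\}$ with the empty sequent. $\mathsf{GLP_{NS}}$ has initial sequents $\Gamma\{p,\overline{p}\}$, $\Gamma\{\top\}$ and rules (premises / conclusion): $\Gamma\{A\}$, $\Gamma\{B\}$ / $\Gamma\{A\wedge B\}$; $\Gamma\{A,B\}$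 / $\Gamma\{A\vee B\}$; $\Gamma\{[A,\Diamond_i\overline{A}]_i\}$ / $\Gamma\{\Box_iA\}$; $\Gamma\{\Diamond_iA,[A,\Delta]_j\}$ / $\Gamma\{\Diamond_iA,[\Delta]_j\}$ ($i\le j$); $\Gamma\{\Diamond_iA,[\Diamond_iA,\Delta]_j\}$ / $\Gamma\{\Diamond_iA,[\Delta]_j\}$ ($i\le j$); $\Gamma\{\Diamond_iA,[\Diamond_iA,\Delta]_j\}$ / $\Gamma\{[\Diamond_iA,\Delta]_j\}$ ($i<j$). $\mathsf{GLP_{NS}}+\mathsf{cut}(\mathcal{C})$ adds the rule $\Gamma\{A\}$, $\Gamma\{\overline{A}\}$ / $\Gamma\{\emptyset\}$ restricted to formulas $A\in\mathcal{C}$. -}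

module Defs where

open import Data.Nat using (ℕ; _≤_; _<_)
open import Data.List using (List; []; _∷_; _++_)
open import Data.List.Membership.Propositional using (_∈_)

-- Formulas in negation normal form (atoms are natural numbers).
data Fm : Set where
  var  : ℕ → Fm
  nvar : ℕ → Fm
  ⊤′   : Fm
  ⊥′   : Fm
  _∧′_ : Fm → Fm → Fm
  _∨′_ : Fm → Fm → Fm
  □    : ℕ → Fm → Fm
  ◇    : ℕ → Fm → Fm

neg : Fm → Fm
neg (var p)  = nvar p
neg (nvar p) = var p
neg ⊤′       = ⊥′
neg ⊥′       = ⊤′
neg (A ∧′ B) = neg A ∨′ neg B
neg (A ∨′ B) = neg A ∧′ neg B
neg (□ i A)  = ◇ i (neg A)
neg (◇ i A)  = □ i (neg A)

data ImmSub : Fm → Fm → Set where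
  ∧l : ∀ {A B} → ImmSub A (A ∧′ B)
  ∧r : ∀ {A B} → ImmSub B (A ∧′ B)
  ∨l : ∀ {A B} → ImmSub A (A ∨′ B)
  ∨r : ∀ {A B} → ImmSub B (A ∨′ B)
  □s : ∀ {i A} → ImmSub A (□ i A)
  ◇s : ∀ {i A} → ImmSub A (◇ i A)

-- A finite set of formulas (given as a list) is adequate if it is closed
-- under (immediate, hence all) subformulas and under negation.
record Adequate (𝒞 : List Fm) : Set where
  field
    sub-closed : ∀ {A B} → A ∈ 𝒞 → ImmSub B A → B ∈ 𝒞
    neg-closed : ∀ {A} → A ∈ 𝒞 → neg A ∈ 𝒞

-- Nested sequents: finite multisets (lists up to _≈_ below) of formulas
-- and bracketed nested sequents [Δ]_i.
data Item : Set where
  fm : Fm → Item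
  br : ℕ → List Item → Item

Seq : Set
Seq = List Item

mutual
  data _≈_ : Seq → Seq → Set where
    []≈   : [] ≈ []
    cons≈ : ∀ {x y xs ys} → x ≈ᵢ y → xs ≈ ys → (x ∷ xs) ≈ (y ∷ ys)
    swap≈ : ∀ {x y xs} → (x ∷ y ∷ xs) ≈ (y ∷ x ∷ xs)
    trans≈ : ∀ {xs ys zs} → xs ≈ ys → ys ≈ zs → xs ≈ zs

  data _≈ᵢ_ : Item → Item → Set where
    fm≈ : ∀ {A} → fm A ≈ᵢ fm A
    br≈ : ∀ {i Δ Σ} → Δ ≈ Σ → br i Δ ≈ᵢ br i Σ

data Ctx : Set where
  top   : Seq → Ctx
  under : ℕ → Ctx → Seq → Ctx

infixl 30 _⟨_⟩
_⟨_⟩ : Ctx → Seq → Seq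
top Δ ⟨ X ⟩       = X ++ Δ
under i Γ Δ ⟨ X ⟩ = br i (Γ ⟨ X ⟩) ∷ Δ

infix 4 ⊢[_]_
data ⊢[_]_ (𝒞 : List Fm) : Seq → Set where
  ax   : ∀ Γ p → ⊢[ 𝒞 ] Γ ⟨ fm (var p) ∷ fm (nvar p) ∷ [] ⟩
  ax⊤  : ∀ Γ → ⊢[ 𝒞 ] Γ ⟨ fm ⊤′ ∷ [] ⟩
  ∧R   : ∀ Γ A B → ⊢[ 𝒞 ] Γ ⟨ fm A ∷ [] ⟩ → ⊢[ 𝒞 ] Γ ⟨ fm B ∷ [] ⟩
         → ⊢[ 𝒞 ] Γ ⟨ fm (A ∧′ B) ∷ [] ⟩
  ∨R   : ∀ Γ A B → ⊢[ 𝒞 ] Γ ⟨ fm A ∷ fm B ∷ [] ⟩ → ⊢[ 𝒞 ] Γ ⟨ fm (A ∨′ B) ∷ [] ⟩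
  □R   : ∀ Γ i A → ⊢[ 𝒞 ] Γ ⟨ br i (fm A ∷ fm (◇ i (neg A)) ∷ []) ∷ [] ⟩
         → ⊢[ 𝒞 ] Γ ⟨ fm (□ i A) ∷ [] ⟩
  ◇R₁  : ∀ Γ i j A Δ → i ≤ j
         → ⊢[ 𝒞 ] Γ ⟨ fm (◇ i A) ∷ br j (fm A ∷ Δ) ∷ [] ⟩
         → ⊢[ 𝒞 ] Γ ⟨ fm (◇ i A) ∷ br j Δ ∷ [] ⟩
  ◇R₂  : ∀ Γ i j A Δ → i ≤ j
         → ⊢[ 𝒞 ] Γ ⟨ fm (◇ i A) ∷ br j (fm (◇ i A) ∷ Δ) ∷ [] ⟩
         → ⊢[ 𝒞 ] Γ ⟨ fm (◇ i A) ∷ br j Δ ∷ [] ⟩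
  ◇R₃  : ∀ Γ i j A Δ → i < j
         → ⊢[ 𝒞 ] Γ ⟨ fm (◇ i A) ∷ br j (fm (◇ i A) ∷ Δ) ∷ [] ⟩
         → ⊢[ 𝒞 ] Γ ⟨ br j (fm (◇ i A) ∷ Δ) ∷ [] ⟩
  cut  : ∀ Γ A → A ∈ 𝒞 → ⊢[ 𝒞 ] Γ ⟨ fm A ∷ [] ⟩ → ⊢[ 𝒞 ] Γ ⟨ fm (neg A) ∷ [] ⟩
         → ⊢[ 𝒞 ] Γ ⟨ [] ⟩
  -- sequents are multisets: provability is invariant under _≈_
  exch : ∀ {Γ Γ′} → Γ ≈ Γ′ → ⊢[ 𝒞 ] Γ → ⊢[ 𝒞 ] Γ′

module Submission where

-- All three rules are instances of one "absorption" preorder S ⊑ T on nested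
-- sequents: each formula of S occurs in T, and each bracket [Δ]_i of S is sent
-- to a bracket [Σ]_j of T with i ≤ j and Δ absorbed into a part of Σ; several
-- brackets of S may land in disjoint parts of the same bracket of T, and T may
-- contain extra material.  Weakening is [] ⊑ Δ, merge is [Δ]_i,[Σ]_i ⊑ [Δ,Σ]_i,
-- monotonicity is [Δ]_i ⊑ [Δ]_j, and ⊑ is preserved by plugging into contexts.
--
-- The main result `admissible` states that provability is upward closed under
-- ⊑, by induction on derivations.  For a rule instance with principal part C
-- in context Γ, an absorption of Γ{C} into T is analysed locally: T ≈ Γ'{C'}
-- where C' is again a principal part of the same rule, and the premises at Γ{C}
-- are absorbed into those at Γ'{C'}.

open import Defs
open import Data.Nat using (ℕ; _≤_; _<_)
open import Data.Nat.Properties using (≤-refl; ≤-trans; <-≤-trans)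
open import Data.List using (List; []; _∷_; _++_; map)
open import Data.List.Properties using (++-identityʳ; ++-assoc)
open import Data.Product using (_×_; Σ; _,_; proj₁; proj₂)
open import Data.Sum using (_⊎_; inj₁; inj₂)
open import Data.Unit using (⊤; tt)
open import Data.Bool using (Bool; true; false)
open import Relation.Binary.PropositionalEquality using (_≡_; refl; sym)

mutual
  ≈-refl : ∀ xs → xs ≈ xs
  ≈-refl []       = []≈
  ≈-refl (x ∷ xs) = cons≈ (≈ᵢ-refl x) (≈-refl xs)

  ≈ᵢ-refl : ∀ x → x ≈ᵢ x
  ≈ᵢ-refl (fm A)   = fm≈
  ≈ᵢ-refl (br i Δ) = br≈ (≈-refl Δ)

mutual
  ≈-sym : ∀ {xs ys} → xs ≈ ys → ys ≈ xs
  ≈-sym []≈          = []≈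
  ≈-sym (cons≈ p q)  = cons≈ (≈ᵢ-sym p) (≈-sym q)
  ≈-sym swap≈        = swap≈
  ≈-sym (trans≈ p q) = trans≈ (≈-sym q) (≈-sym p)

  ≈ᵢ-sym : ∀ {x y} → x ≈ᵢ y → y ≈ᵢ x
  ≈ᵢ-sym fm≈     = fm≈
  ≈ᵢ-sym (br≈ p) = br≈ (≈-sym p)

≈ᵢ-trans : ∀ {x y z} → x ≈ᵢ y → y ≈ᵢ z → x ≈ᵢ z
≈ᵢ-trans fm≈     fm≈     = fm≈
≈ᵢ-trans (br≈ p) (br≈ q) = br≈ (trans≈ p q)

≡⇒≈ : ∀ {xs ys} → xs ≡ ys → xs ≈ ys
≡⇒≈ {xs} refl = ≈-refl xs

≈-++ʳ : ∀ {xs ys} zs → xs ≈ ys → (xs ++ zs) ≈ (ys ++ zs)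
≈-++ʳ zs []≈          = ≈-refl zs
≈-++ʳ zs (cons≈ p q)  = cons≈ p (≈-++ʳ zs q)
≈-++ʳ zs swap≈        = swap≈
≈-++ʳ zs (trans≈ p q) = trans≈ (≈-++ʳ zs p) (≈-++ʳ zs q)

≈-++ˡ : ∀ zs {xs ys} → xs ≈ ys → (zs ++ xs) ≈ (zs ++ ys)
≈-++ˡ []       p = p
≈-++ˡ (z ∷ zs) p = cons≈ (≈ᵢ-refl z) (≈-++ˡ zs p)

≈-++-identityʳ : ∀ xs → xs ≈ (xs ++ [])
≈-++-identityʳ xs = ≡⇒≈ (sym (++-identityʳ xs))

≈-to-front : ∀ c y d → (c ++ y ∷ d) ≈ (y ∷ c ++ d)
≈-to-front []      y d = ≈-refl (y ∷ d)
≈-to-front (z ∷ c) y d = trans≈ (cons≈ (≈ᵢ-refl z) (≈-to-front c y d)) swap≈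

≈-++-comm : ∀ a b → (a ++ b) ≈ (b ++ a)
≈-++-comm []      b = ≈-++-identityʳ b
≈-++-comm (x ∷ a) b =
  trans≈ (cons≈ (≈ᵢ-refl x) (≈-++-comm a b)) (≈-sym (≈-to-front b x a))

≈-++-swap : ∀ a b c → (a ++ (b ++ c)) ≈ (b ++ (a ++ c))
≈-++-swap a b c = trans≈ (≡⇒≈ (sym (++-assoc a b c)))
                    (trans≈ (≈-++ʳ c (≈-++-comm a b)) (≡⇒≈ (++-assoc b a c)))

≈-locate : ∀ {xs ys} → xs ≈ ys → ∀ a x b → xs ≡ a ++ x ∷ b →
  Σ Seq λ c → Σ Item λ y → Σ Seq λ d →
    (ys ≡ c ++ y ∷ d) × (x ≈ᵢ y) × ((a ++ b) ≈ (c ++ d))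
≈-locate []≈ [] x b ()
≈-locate []≈ (_ ∷ _) x b ()
≈-locate (cons≈ {y = y} {ys = ys} p q) [] x b refl = [] , y , ys , refl , p , q
≈-locate (cons≈ {y = y₀} p q) (_ ∷ a) x b refl with ≈-locate q a x b refl
... | c , y , d , refl , x≈y , rest = y₀ ∷ c , y , d , refl , x≈y , cons≈ p rest
≈-locate (swap≈ {x = x₀} {y = y₀} {xs = xs}) [] x b refl =
  y₀ ∷ [] , x₀ , xs , refl , ≈ᵢ-refl x₀ , ≈-refl (y₀ ∷ xs)
≈-locate (swap≈ {x = x₀} {y = y₀} {xs = xs}) (_ ∷ []) x b refl =
  [] , y₀ , x₀ ∷ xs , refl , ≈ᵢ-refl y₀ , ≈-refl (x₀ ∷ xs)
≈-locate (swap≈ {x = x₀} {y = y₀}) (_ ∷ _ ∷ a) x b refl =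
  y₀ ∷ x₀ ∷ a , x , b , refl , ≈ᵢ-refl x , swap≈
≈-locate (trans≈ p q) a x b eq with ≈-locate p a x b eq
... | c , y , d , eq′ , x≈y , rest with ≈-locate q c y d eq′
... | c′ , y′ , d′ , eq″ , y≈y′ , rest′ =
  c′ , y′ , d′ , eq″ , ≈ᵢ-trans x≈y y≈y′ , trans≈ rest rest′

≈-uncons : ∀ {x X b Y} → (x ∷ X) ≈ (b ∷ Y) →
  ((x ≈ᵢ b) × (X ≈ Y)) ⊎
  (Σ Seq λ R → Σ Item λ y → (X ≈ (b ∷ R)) × (Y ≈ (y ∷ R)) × (x ≈ᵢ y))
≈-uncons {x} {X} e with ≈-locate e [] x X refl
... | []    , y , d , refl , x≈y , rest = inj₁ (x≈y , rest)
... | _ ∷ c , y , d , refl , x≈y , rest = inj₂ (c ++ d , y , rest , ≈-to-front c y d , x≈y)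

-- S ⊑ T ⇝ U: S is absorbed into T with remainder U.  A formula
-- of S consumes an occurrence of it in T; a bracket [Δ]_i consumes a part Σ₁
-- of a bracket [Σ₁,Σ₂]_j of T with i ≤ j, absorbing Δ into Σ₁ (whose own
-- remainder is discarded) while [Σ₂]_j stays available to the rest of S.
infix 4 _⊑_⇝_ _⊑_
data _⊑_⇝_ : Seq → Seq → Seq → Set where
  done    : ∀ {T U} → T ≈ U → [] ⊑ T ⇝ U
  take-fm : ∀ {A S T T′ U} → T ≈ (fm A ∷ T′) → S ⊑ T′ ⇝ U → fm A ∷ S ⊑ T ⇝ U
  take-br : ∀ {i j Δ S T T′ U W Σ₁ Σ₂} → i ≤ j → T ≈ (br j (Σ₁ ++ Σ₂) ∷ T′)
            → Δ ⊑ Σ₁ ⇝ W → S ⊑ br j Σ₂ ∷ T′ ⇝ U → br i Δ ∷ S ⊑ T ⇝ U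

_⊑_ : Seq → Seq → Set
S ⊑ T = Σ Seq λ U → S ⊑ T ⇝ U

⊑-respʳ : ∀ {S T T₂ U} → T₂ ≈ T → S ⊑ T ⇝ U → S ⊑ T₂ ⇝ U
⊑-respʳ p (done e)              = done (trans≈ p e)
⊑-respʳ p (take-fm e a)         = take-fm (trans≈ p e) a
⊑-respʳ p (take-br le e a₁ a₂) = take-br le (trans≈ p e) a₁ a₂

⊑-swap : ∀ {x y S T U} → x ∷ y ∷ S ⊑ T ⇝ U → y ∷ x ∷ S ⊑ T ⇝ U
⊑-swap (take-fm e₁ (take-fm e₂ a)) =
  take-fm (trans≈ e₁ (trans≈ (cons≈ fm≈ e₂) swap≈)) (take-fm (≈-refl _) a)
⊑-swap (take-fm e₁ (take-br le e₂ a₁ a₂)) =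
  take-br le (trans≈ e₁ (trans≈ (cons≈ fm≈ e₂) swap≈)) a₁ (take-fm swap≈ a₂)
⊑-swap (take-br le e₁ a₁ (take-fm e₂ a)) with ≈-uncons e₂
... | inj₁ (() , _)
... | inj₂ (R , br _ _ , r₁ , r₂ , br≈ q) =
  take-fm (trans≈ e₁ (trans≈ (cons≈ (≈ᵢ-refl _) r₁) swap≈))
    (take-br le (≈-refl _) a₁
      (⊑-respʳ (trans≈ (cons≈ (br≈ q) (≈-refl R)) (≈-sym r₂)) a))
⊑-swap (take-br {Σ₁ = Σ₁} le₁ e₁ a₁ (take-br {Σ₁ = Π₁} {Σ₂ = Π₂} le₂ e₂ a₃ a₄))
  with ≈-uncons e₂
... | inj₁ (br≈ q , r) =
  take-br le₂
    (trans≈ e₁ (cons≈ (br≈ (trans≈ (≈-++ˡ Σ₁ q) (≈-++-swap Σ₁ Π₁ Π₂))) r)) a₃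
    (take-br le₁ (≈-refl _) a₁ a₄)
... | inj₂ (R , br _ _ , r₁ , r₂ , br≈ q) =
  take-br le₂ (trans≈ e₁ (trans≈ (cons≈ (≈ᵢ-refl _) r₁) swap≈)) a₃
    (take-br le₁ swap≈ a₁
      (⊑-respʳ (trans≈ swap≈
        (cons≈ (≈ᵢ-refl _) (trans≈ (cons≈ (br≈ q) (≈-refl R)) (≈-sym r₂)))) a₄))

⊑-respˡ : ∀ {S S′ T U} → S ≈ S′ → S ⊑ T ⇝ U → S′ ⊑ T ⇝ U
⊑-respˡ []≈                    a                     = a
⊑-respˡ (cons≈ fm≈ q)          (take-fm e a)         = take-fm e (⊑-respˡ q a)
⊑-respˡ (cons≈ (br≈ p) q)      (take-br le e a₁ a₂) =
  take-br le e (⊑-respˡ p a₁) (⊑-respˡ q a₂)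
⊑-respˡ swap≈                  a                     = ⊑-swap a
⊑-respˡ (trans≈ p q)           a                     = ⊑-respˡ q (⊑-respˡ p a)

⊑-split : ∀ X {Y T U} → X ++ Y ⊑ T ⇝ U → Σ Seq λ V → (X ⊑ T ⇝ V) × (Y ⊑ V ⇝ U)
⊑-split []           {T = T} a = T , done (≈-refl T) , a
⊑-split (fm A ∷ X)   (take-fm e a) with ⊑-split X a
... | V , a₁ , a₂ = V , take-fm e a₁ , a₂
⊑-split (br i Δ ∷ X) (take-br le e a₀ a) with ⊑-split X a
... | V , a₁ , a₂ = V , take-br le e a₀ a₁ , a₂

⊑-++ : ∀ {X Y T V U} → X ⊑ T ⇝ V → Y ⊑ V ⇝ U → X ++ Y ⊑ T ⇝ U
⊑-++ (done e)              b = ⊑-respʳ e b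
⊑-++ (take-fm e a)         b = take-fm e (⊑-++ a b)
⊑-++ (take-br le e a₀ a)   b = take-br le e a₀ (⊑-++ a b)

⊑-cons : ∀ x {S T U} → S ⊑ T ⇝ U → S ⊑ x ∷ T ⇝ x ∷ U
⊑-cons x (done e)              = done (cons≈ (≈ᵢ-refl x) e)
⊑-cons x (take-fm e a)         = take-fm (trans≈ (cons≈ (≈ᵢ-refl x) e) swap≈) (⊑-cons x a)
⊑-cons x (take-br le e a₁ a₂) =
  take-br le (trans≈ (cons≈ (≈ᵢ-refl x) e) swap≈) a₁ (⊑-respʳ swap≈ (⊑-cons x a₂))

⊑-prefix : ∀ J {S T U} → S ⊑ T ⇝ U → S ⊑ J ++ T ⇝ J ++ U
⊑-prefix []      a = a
⊑-prefix (x ∷ J) a = ⊑-cons x (⊑-prefix J a)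

⊑-suffix : ∀ Z {S T U} → S ⊑ T ⇝ U → S ⊑ T ++ Z ⇝ U ++ Z
⊑-suffix Z (done e)              = done (≈-++ʳ Z e)
⊑-suffix Z (take-fm e a)         = take-fm (≈-++ʳ Z e) (⊑-suffix Z a)
⊑-suffix Z (take-br le e a₁ a₂) = take-br le (≈-++ʳ Z e) a₁ (⊑-suffix Z a₂)

⊑-br : ∀ {i j Δ Σ′ W S T U} → i ≤ j → Δ ⊑ Σ′ ⇝ W → S ⊑ T ⇝ U
       → br i Δ ∷ S ⊑ br j Σ′ ∷ T ⇝ br j [] ∷ U
⊑-br {Σ′ = Σ′} {T = T} le a b =
  take-br le (cons≈ (br≈ (≈-++-identityʳ Σ′)) (≈-refl T)) a (⊑-cons (br _ []) b)

⊑-self : ∀ S → Σ Seq λ J → S ⊑ S ⇝ J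
⊑-self []           = [] , done []≈
⊑-self (fm A ∷ S)   = proj₁ (⊑-self S) , take-fm (≈-refl _) (proj₂ (⊑-self S))
⊑-self (br i Δ ∷ S) = br i [] ∷ proj₁ (⊑-self S) ,
                      ⊑-br ≤-refl (proj₂ (⊑-self Δ)) (proj₂ (⊑-self S))

⊑-self-++ : ∀ P V → Σ Seq λ J → P ⊑ P ++ V ⇝ J ++ V
⊑-self-++ P V = proj₁ (⊑-self P) , ⊑-suffix V (proj₂ (⊑-self P))

⊑-plug : ∀ Γ {X Y} → X ⊑ Y → Γ ⟨ X ⟩ ⊑ Γ ⟨ Y ⟩
⊑-plug (top Δ) (J , a) =
  J ++ proj₁ (⊑-self Δ) , ⊑-++ (⊑-suffix Δ a) (⊑-prefix J (proj₂ (⊑-self Δ)))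
⊑-plug (under i Γ Δ) m =
  br i [] ∷ proj₁ (⊑-self Δ) , ⊑-br ≤-refl (proj₂ (⊑-plug Γ m)) (proj₂ (⊑-self Δ))

_+c_ : Ctx → Seq → Ctx
top Δ       +c Σ′ = top (Δ ++ Σ′)
under i Γ Δ +c Σ′ = under i Γ (Δ ++ Σ′)

plug-+c : ∀ Γ X Σ′ → (Γ ⟨ X ⟩ ++ Σ′) ≡ ((Γ +c Σ′) ⟨ X ⟩)
plug-+c (top Δ)       X Σ′ = ++-assoc X Δ Σ′
plug-+c (under i Γ Δ) X Σ′ = refl

-- Local analysis of a rule instance with principal part C and premises P k
-- (k : Prem): whenever C is absorbed into T with remainder V, T splits as
-- C′ ++ R, where C′ has shape K (with premises P′), and every premise P k is
-- absorbed into P′ k ++ R with a remainder extending V.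
Local : Seq → (Prem : Set) → (Prem → Seq) → (Seq → (Prem → Seq) → Set) → Set
Local C Prem P K = ∀ T V → C ⊑ T ⇝ V →
  Σ Seq λ R → Σ Seq λ C′ → Σ (Prem → Seq) λ P′ →
    (T ≈ (C′ ++ R)) × (∀ k → Σ Seq λ J → P k ⊑ P′ k ++ R ⇝ J ++ V) × K C′ P′

lift : ∀ (Γ : Ctx) {C Prem P K} → Local C Prem P K → ∀ T → Γ ⟨ C ⟩ ⊑ T →
  Σ Ctx λ Γ′ → Σ Seq λ C′ → Σ (Prem → Seq) λ P′ →
    (T ≈ (Γ′ ⟨ C′ ⟩)) × (∀ k → Γ ⟨ P k ⟩ ⊑ Γ′ ⟨ P′ k ⟩) × K C′ P′
lift (top Δ) {C} loc T (U , a) with ⊑-split C a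
... | V , a₁ , a₂ with loc T V a₁
... | R , C′ , P′ , T≈ , prem , κ =
  top R , C′ , P′ , T≈ ,
  (λ k → let J = proj₁ (prem k) in J ++ U , ⊑-++ (proj₂ (prem k)) (⊑-prefix J a₂)) , κ
lift (under i Γ Δ) loc T (U , take-br {j = j} {T′ = T′} {W = W} {Σ₂ = Σ₂} le e a₁ a₂)
  with lift Γ loc _ (W , a₁)
... | Γ₁ , C′ , P′ , Σ₁≈ , prem , κ =
  under j (Γ₁ +c Σ₂) T′ , C′ , P′ ,
  trans≈ e (cons≈ (br≈ (trans≈ (≈-++ʳ Σ₂ Σ₁≈) (≡⇒≈ (plug-+c Γ₁ C′ Σ₂)))) (≈-refl T′)) ,
  (λ k → U , take-br le (cons≈ (br≈ (≡⇒≈ (sym (plug-+c Γ₁ (P′ k) Σ₂)))) (≈-refl T′))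
                     (proj₂ (prem k)) a₂) ,
  κ

-- Rules whose principal part consists of formulas only.
Unchanged : ∀ {Prem : Set} → Seq → (Prem → Seq) → Seq → (Prem → Seq) → Set
Unchanged C P C′ P′ = (C′ ≡ C) × (P′ ≡ P)

formulas-⊑ : ∀ Fs {T V} → map fm Fs ⊑ T ⇝ V → T ≈ (map fm Fs ++ V)
formulas-⊑ []       (done e)      = e
formulas-⊑ (A ∷ Fs) (take-fm e a) = trans≈ e (cons≈ fm≈ (formulas-⊑ Fs a))

formulas-local : ∀ Fs Prem P → Local (map fm Fs) Prem P (Unchanged (map fm Fs) P)
formulas-local Fs Prem P T V a =
  V , map fm Fs , P , formulas-⊑ Fs a , (λ k → ⊑-self-++ (P k) V) , refl , refl

-- The rules ◇R₁, ◇R₂ with principal part ◇_iA,[Δ]_j and premise ◇_iA,[B,Δ]_j: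
-- the bracket may be absorbed into a bracket of larger index i ≤ j ≤ j′.
Diamond-shape : ℕ → Fm → Fm → Seq → (⊤ → Seq) → Set
Diamond-shape i A B C′ P′ = Σ ℕ λ j′ → Σ Seq λ Σ′ → (i ≤ j′) ×
  (C′ ≡ fm (◇ i A) ∷ br j′ Σ′ ∷ []) × (P′ ≡ λ _ → fm (◇ i A) ∷ br j′ (fm B ∷ Σ′) ∷ [])

diamond-local : ∀ i j A B Δ → i ≤ j →
  Local (fm (◇ i A) ∷ br j Δ ∷ []) ⊤ (λ _ → fm (◇ i A) ∷ br j (fm B ∷ Δ) ∷ [])
        (Diamond-shape i A B)
diamond-local i j A B Δ i≤j T V
  (take-fm e₁ (take-br {j = j′} {T′ = T₂} {Σ₁ = Σ₁} {Σ₂ = Σ₂} le e₂ a (done e₃))) =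
  T₂ , fm (◇ i A) ∷ br j′ (Σ₁ ++ Σ₂) ∷ [] ,
  (λ _ → fm (◇ i A) ∷ br j′ (fm B ∷ Σ₁ ++ Σ₂) ∷ []) ,
  trans≈ e₁ (cons≈ fm≈ e₂) ,
  (λ _ → [] , take-fm (≈-refl _)
     (take-br {Σ₁ = fm B ∷ Σ₁} le (≈-refl _) (take-fm (≈-refl _) a) (done e₃))) ,
  (j′ , Σ₁ ++ Σ₂ , ≤-trans i≤j le , refl , refl)

Diamond-up-shape : ℕ → Fm → Seq → (⊤ → Seq) → Set
Diamond-up-shape i A C′ P′ = Σ ℕ λ j′ → Σ Seq λ Σ′ → (i < j′) ×
  (C′ ≡ br j′ (fm (◇ i A) ∷ Σ′) ∷ []) ×
  (P′ ≡ λ _ → fm (◇ i A) ∷ br j′ (fm (◇ i A) ∷ Σ′) ∷ [])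

diamond-up-local : ∀ i j A Δ → i < j →
  Local (br j (fm (◇ i A) ∷ Δ) ∷ []) ⊤
        (λ _ → fm (◇ i A) ∷ br j (fm (◇ i A) ∷ Δ) ∷ []) (Diamond-up-shape i A)
diamond-up-local i j A Δ i<j T V
  (take-br {j = j′} {T′ = T₁} {Σ₂ = Σ₂} le e₁ (take-fm {T′ = Σ₁′} e₂ a) (done e₃)) =
  T₁ , br j′ (fm (◇ i A) ∷ Σ₁′ ++ Σ₂) ∷ [] ,
  (λ _ → fm (◇ i A) ∷ br j′ (fm (◇ i A) ∷ Σ₁′ ++ Σ₂) ∷ []) ,
  trans≈ e₁ (cons≈ (br≈ (≈-++ʳ Σ₂ e₂)) (≈-refl T₁)) ,
  (λ _ → [] , take-fm (≈-refl _)
     (take-br {Σ₁ = fm (◇ i A) ∷ Σ₁′} le (≈-refl _) (take-fm (≈-refl _) a) (done e₃))) ,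
  (j′ , Σ₁′ ++ Σ₂ , <-≤-trans i<j le , refl , refl)

admissible : ∀ {𝒞 S} → ⊢[ 𝒞 ] S → ∀ T → S ⊑ T → ⊢[ 𝒞 ] T
admissible (ax Γ p) T m
  with lift Γ (formulas-local (var p ∷ nvar p ∷ []) ⊤ (λ _ → [])) T m
... | Γ′ , _ , _ , T≈ , _ , refl , refl = exch (≈-sym T≈) (ax Γ′ p)
admissible (ax⊤ Γ) T m with lift Γ (formulas-local (⊤′ ∷ []) ⊤ (λ _ → [])) T m
... | Γ′ , _ , _ , T≈ , _ , refl , refl = exch (≈-sym T≈) (ax⊤ Γ′)
admissible (∧R Γ A B d₁ d₂) T m
  with lift Γ (formulas-local (A ∧′ B ∷ []) Bool
                 (λ { true → fm A ∷ [] ; false → fm B ∷ [] })) T m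
... | Γ′ , _ , _ , T≈ , prem , refl , refl =
  exch (≈-sym T≈) (∧R Γ′ A B (admissible d₁ _ (prem true)) (admissible d₂ _ (prem false)))
admissible (∨R Γ A B d) T m
  with lift Γ (formulas-local (A ∨′ B ∷ []) ⊤ (λ _ → fm A ∷ fm B ∷ [])) T m
... | Γ′ , _ , _ , T≈ , prem , refl , refl =
  exch (≈-sym T≈) (∨R Γ′ A B (admissible d _ (prem tt)))
admissible (□R Γ i A d) T m
  with lift Γ (formulas-local (□ i A ∷ []) ⊤
                 (λ _ → br i (fm A ∷ fm (◇ i (neg A)) ∷ []) ∷ [])) T m
... | Γ′ , _ , _ , T≈ , prem , refl , refl =
  exch (≈-sym T≈) (□R Γ′ i A (admissible d _ (prem tt)))
admissible (◇R₁ Γ i j A Δ i≤j d) T m with lift Γ (diamond-local i j A A Δ i≤j) T m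
... | Γ′ , _ , _ , T≈ , prem , (j′ , Σ′ , i≤j′ , refl , refl) =
  exch (≈-sym T≈) (◇R₁ Γ′ i j′ A Σ′ i≤j′ (admissible d _ (prem tt)))
admissible (◇R₂ Γ i j A Δ i≤j d) T m with lift Γ (diamond-local i j A (◇ i A) Δ i≤j) T m
... | Γ′ , _ , _ , T≈ , prem , (j′ , Σ′ , i≤j′ , refl , refl) =
  exch (≈-sym T≈) (◇R₂ Γ′ i j′ A Σ′ i≤j′ (admissible d _ (prem tt)))
admissible (◇R₃ Γ i j A Δ i<j d) T m with lift Γ (diamond-up-local i j A Δ i<j) T m
... | Γ′ , _ , _ , T≈ , prem , (j′ , Σ′ , i<j′ , refl , refl) =
  exch (≈-sym T≈) (◇R₃ Γ′ i j′ A Σ′ i<j′ (admissible d _ (prem tt)))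
admissible (cut Γ A A∈𝒞 d₁ d₂) T m
  with lift Γ (formulas-local [] Bool
                 (λ { true → fm A ∷ [] ; false → fm (neg A) ∷ [] })) T m
... | Γ′ , _ , _ , T≈ , prem , refl , refl =
  exch (≈-sym T≈) (cut Γ′ A A∈𝒞 (admissible d₁ _ (prem true)) (admissible d₂ _ (prem false)))
admissible (exch e d) T (U , a) = admissible d T (U , ⊑-respˡ (≈-sym e) a)

weakening-⊑ : ∀ Δ → [] ⊑ Δ
weakening-⊑ Δ = Δ , done (≈-refl Δ)

merge-⊑ : ∀ i Δ Σ′ → br i Δ ∷ br i Σ′ ∷ [] ⊑ br i (Δ ++ Σ′) ∷ []
merge-⊑ i Δ Σ′ =
  proj₁ (⊑-self (br i Σ′ ∷ [])) ,
  take-br ≤-refl (≈-refl _) (proj₂ (⊑-self Δ)) (proj₂ (⊑-self (br i Σ′ ∷ [])))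

monotone-⊑ : ∀ {i j} Δ → i ≤ j → br i Δ ∷ [] ⊑ br j Δ ∷ []
monotone-⊑ Δ le = br _ [] ∷ [] , ⊑-br le (proj₂ (⊑-self Δ)) (done []≈)

lemma4 : (𝒞 : List Fm) → Adequate 𝒞
    → ((Γ : Ctx) (Δ : Seq) → ⊢[ 𝒞 ] Γ ⟨ [] ⟩ → ⊢[ 𝒞 ] Γ ⟨ Δ ⟩)
    × ((Γ : Ctx) (i : ℕ) (Δ Σ : Seq)
        → ⊢[ 𝒞 ] Γ ⟨ br i Δ ∷ br i Σ ∷ [] ⟩ → ⊢[ 𝒞 ] Γ ⟨ br i (Δ ++ Σ) ∷ [] ⟩)
    × ((Γ : Ctx) (i j : ℕ) (Δ : Seq) → i ≤ j
        → ⊢[ 𝒞 ] Γ ⟨ br i Δ ∷ [] ⟩ → ⊢[ 𝒞 ] Γ ⟨ br j Δ ∷ [] ⟩)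
lemma4 𝒞 _ =
  (λ Γ Δ d → admissible d _ (⊑-plug Γ (weakening-⊑ Δ))) ,
  (λ Γ i Δ Σ′ d → admissible d _ (⊑-plug Γ (merge-⊑ i Δ Σ′))) ,
  (λ Γ i j Δ le d → admissible d _ (⊑-plug Γ (monotone-⊑ Δ le)))
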